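{- Let $\mathcal{C}\subseteq\mathbb{S}_n$ be a $2$-balanced code and let $A_n\le\mathbb{S}_n$ be the subgroup of even permutations. Then $\mathcal{C}=\{\sigma\pi:\pi\in A_n\}$ for some $\sigma\in\mathbb{S}_n$ (i.e. $\mathcal{C}$ is a coset of $A_n$).
   Context: $\mathbb{S}_n$ is the group of permutations of $[n]=\{1,\dots,n\}$, written in one-line notation. The Kendall-$\tau$ distance $\mathrm{d}_\mathrm{K}(\sigma,\tau)$ is the minimum number of adjacent transpositions (swaps of two consecutive entries in one-line notation) needed to obtain $\sigma$ from $\tau$. A code is a subset $\mathcal{C}\subseteq\mathbb{S}_n$ with $|\mathcal{C}|\ge2$, with minimum distance $\mathrm{d}_\mathrm{K}(\mathcal{C})=\min\{\mathrm{d}_\mathrm{K}(\sigma,\tau):\sigma\ne\tau\in\mathcal{C}\}$. A code $\mathcal{C}\subseteq\mathbb{S}_n$ is $2$-balanced if $\mathrm{d}_\mathrm{K}(\mathcal{C})>1$ and $|\mathcal{C}|=n!/2$. Since $A_n$ is normal, left and right cosets of $A_n$ coincide. -}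

module Defs where

open import Data.Nat using (ℕ; zero; suc; _<_; _≤_)
open import Data.Nat.Divisibility using (_∣_)
open import Data.Nat using (_!)
open import Data.Nat.DivMod using (_/_)
open import Data.Fin using (Fin) renaming (_<?_ to _<ᶠ?_)
open import Data.Vec using (Vec; []; _∷_; lookup; map; count)
open import Data.List using (List; length)
open import Data.List.Membership.Propositional using (_∈_)
open import Data.List.Relation.Unary.All using (All)
open import Data.List.Relation.Unary.Unique.Propositional using (Unique)
open import Data.Product using (Σ; _×_)
open import Relation.Binary.PropositionalEquality using (_≡_; _≢_)

-- Permutations of [n] in one-line notation: a vector of length n over Fin n
-- whose entries are pairwise distinct (i.e. the map i ↦ v[i] is injective,
-- hence bijective).
Perm : ℕ → Set
Perm n = Vec (Fin n) n

IsPerm : ∀ {n} → Perm n → Set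
IsPerm v = ∀ i j → lookup v i ≡ lookup v j → i ≡ j

_∘ₚ_ : ∀ {n} → Perm n → Perm n → Perm n
σ ∘ₚ π = map (lookup σ) π

data AdjSwap {A : Set} : ∀ {m} → Vec A m → Vec A m → Set where
  here  : ∀ {m} {x y : A} {xs : Vec A m} → AdjSwap (x ∷ y ∷ xs) (y ∷ x ∷ xs)
  there : ∀ {m} {x : A} {xs ys : Vec A m} → AdjSwap xs ys → AdjSwap (x ∷ xs) (x ∷ ys)

data Steps {A : Set} {m : ℕ} : ℕ → Vec A m → Vec A m → Set where
  done : ∀ {u} → Steps zero u u
  step : ∀ {k u v w} → AdjSwap u v → Steps k v w → Steps (suc k) u w

DistK : ∀ {n} → Perm n → Perm n → ℕ → Set
DistK σ τ d = Steps d τ σ × (∀ k → Steps k τ σ → d ≤ k)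

inversions : ∀ {m n} → Vec (Fin n) m → ℕ
inversions [] = zero
inversions (x ∷ xs) = count (_<ᶠ? x) xs Data.Nat.+ inversions xs

IsEven : ∀ {n} → Perm n → Set
IsEven v = 2 ∣ inversions v

record IsCode {n} (C : List (Perm n)) : Set where
  field
    perms  : All IsPerm C
    unique : Unique C
    size   : 2 ≤ length C

MinDistGt1 : ∀ {n} → List (Perm n) → Set
MinDistGt1 C = ∀ σ τ → σ ∈ C → τ ∈ C → σ ≢ τ → ∀ d → DistK σ τ d → 1 < d

record TwoBalanced {n} (C : List (Perm n)) : Set where
  field
    code     : IsCode C
    minDist  : MinDistGt1 C
    halfSize : length C ≡ (n !) / 2

{-# OPTIONS --safe #-}

-- Join two permutations by an edge when they differ by one adjacent transposition.
-- A 2-balanced code C is an independent set of size n!/2 in this graph, and it is also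
-- dominating: if neither end of an edge u — v were in C, performing the transposition of
-- that edge on every element of C would give n!/2 permutations outside C and different
-- from u, for n! + 1 permutations in all. Hence membership in C flips along every edge,
-- exactly like the parity of the number of inversions. Every permutation π is reached from
-- the identity along edges (decode its Lehmer code), so for σ ∈ C we get σπ ∈ C iff π is even.
module Submission where

open import Defs
open import Data.Bool using (true; false; if_then_else_)
open import Data.Empty using (⊥)
open import Data.Fin using (Fin; zero; suc; remQuot; combine; punchOut)
  renaming (_<_ to _<ᶠ_; _<?_ to _<ᶠ?_)
open import Data.Fin.Properties using (suc-injective; remQuot-combine; injective⇒≤; <-cmp; <-asym)
  renaming (_≟_ to _≟ᶠ_)
import Data.List as List
open import Data.List using (List; []; _∷_; length; _++_)
open import Data.List.Membership.Propositional using (_∈_; _∉_)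
open import Data.List.Membership.Propositional.Properties using (∈-lookup; ∈-map⁻; ∈-++⁻)
open import Data.List.Properties using (length-++; length-map)
open import Data.List.Relation.Binary.Disjoint.Propositional using (Disjoint)
open import Data.List.Relation.Unary.All as All using (All; _∷_)
import Data.List.Relation.Unary.All.Properties as All
open import Data.List.Relation.Unary.AllPairs using (_∷_)
open import Data.List.Relation.Unary.Any using (here)
open import Data.List.Relation.Unary.Unique.Propositional using (Unique)
import Data.List.Relation.Unary.Unique.Propositional.Properties as Unique
open import Data.Nat using (ℕ; zero; suc; _+_; _*_; _≤_; z≤n; s≤s; _!; parity)
open import Data.Nat.Divisibility using (_∣_; divides; _∣0; ∣-refl; ∣m∣n⇒∣m+n; m≤n⇒m!∣n!)
open import Data.Nat.DivMod using (_/_; m/n*n≡m)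
open import Data.Nat.Properties
  using (+-suc; +-identityʳ; *-comm; <-irrefl; ≤-trans; ≤-reflexive; +-commutativeSemigroup)
open import Algebra.Properties.CommutativeSemigroup +-commutativeSemigroup using (x∙yz≈y∙xz)
open import Data.Parity.Base as ℙ using (Parity; 0ℙ; 1ℙ)
import Data.Parity.Properties as ℙ
open import Data.Product using (Σ; ∃; _×_; _,_; proj₁; proj₂)
open import Data.Sum as Sum using (_⊎_; inj₁; inj₂)
open import Data.Vec using (Vec; []; _∷_; lookup; map; tabulate; allFin; count; removeAt)
open import Data.Vec.Properties
  using (≡-dec; lookup-allFin; map-lookup-allFin; allFin-map; lookup-map; removeAt-punchOut;
         tabulate-∘; tabulate-cong; tabulate∘lookup)
open import Function using (_∘_; id)
open import Function.Bundles using (_⇔_; mk⇔; Equivalence)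
open import Relation.Binary using (tri<; tri≈; tri>)
open import Relation.Binary.PropositionalEquality
  using (_≡_; _≢_; refl; sym; trans; cong; cong₂; subst; ≢-sym; module ≡-Reasoning)
open import Relation.Nullary using (yes; no; does; contradiction)
open import Relation.Nullary.Decidable using (dec-true; dec-false)
open import Relation.Unary using (Decidable)

open ≡-Reasoning

Distinct : ∀ {A : Set} {m} → Vec A m → Set
Distinct v = ∀ i j → lookup v i ≡ lookup v j → i ≡ j

_⊆_ : ∀ {A : Set} {k m} → Vec A k → Vec A m → Set
v ⊆ u = ∀ j → ∃ λ i → lookup u i ≡ lookup v j

_↝_ : ∀ {A : Set} {m} → Vec A m → Vec A m → Set
u ↝ v = ∃ λ k → Steps k u v

module _ {A : Set} where

  Distinct-tail : ∀ {m x} {xs : Vec A m} → Distinct (x ∷ xs) → Distinct xs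
  Distinct-tail d i j e = suc-injective (d (suc i) (suc j) e)

  swapIndex : ∀ {m} {u v : Vec A m} → AdjSwap u v → Fin m → Fin m
  swapIndex here      zero          = suc zero
  swapIndex here      (suc zero)    = zero
  swapIndex here      (suc (suc i)) = suc (suc i)
  swapIndex (there s) zero          = zero
  swapIndex (there s) (suc i)       = suc (swapIndex s i)

  lookup-AdjSwap : ∀ {m} {u v : Vec A m} (s : AdjSwap u v) i → lookup v i ≡ lookup u (swapIndex s i)
  lookup-AdjSwap here      zero          = refl
  lookup-AdjSwap here      (suc zero)    = refl
  lookup-AdjSwap here      (suc (suc i)) = refl
  lookup-AdjSwap (there s) zero          = refl
  lookup-AdjSwap (there s) (suc i)       = lookup-AdjSwap s i

  swapIndex-involutive : ∀ {m} {u v : Vec A m} (s : AdjSwap u v) i → swapIndex s (swapIndex s i) ≡ i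
  swapIndex-involutive here      zero          = refl
  swapIndex-involutive here      (suc zero)    = refl
  swapIndex-involutive here      (suc (suc i)) = refl
  swapIndex-involutive (there s) zero          = refl
  swapIndex-involutive (there s) (suc i)       = cong suc (swapIndex-involutive s i)

  AdjSwap-⊆ : ∀ {m} {u v : Vec A m} → AdjSwap u v → u ⊆ v
  AdjSwap-⊆ {u = u} s j =
    swapIndex s j ,
    trans (lookup-AdjSwap s (swapIndex s j)) (cong (lookup u) (swapIndex-involutive s j))

  Distinct-AdjSwap : ∀ {m} {u v : Vec A m} → AdjSwap u v → Distinct u → Distinct v
  Distinct-AdjSwap {u = u} s d i j vᵢ≡vⱼ = begin
    i                           ≡⟨ swapIndex-involutive s i ⟨
    swapIndex s (swapIndex s i) ≡⟨ cong (swapIndex s) (d _ _ uₛᵢ≡uₛⱼ) ⟩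
    swapIndex s (swapIndex s j) ≡⟨ swapIndex-involutive s j ⟩
    j                           ∎
    where
    uₛᵢ≡uₛⱼ : lookup u (swapIndex s i) ≡ lookup u (swapIndex s j)
    uₛᵢ≡uₛⱼ = trans (sym (lookup-AdjSwap s i)) (trans vᵢ≡vⱼ (lookup-AdjSwap s j))

  AdjSwap-≢ : ∀ {m} {u v : Vec A m} → AdjSwap u v → Distinct u → u ≢ v
  AdjSwap-≢ here      d refl = contradiction (d zero (suc zero) refl) λ ()
  AdjSwap-≢ (there s) d refl = AdjSwap-≢ s (Distinct-tail d) refl

  swapLike : ∀ {B : Set} {m} {u v : Vec A m} → AdjSwap u v → Vec B m → Vec B m
  swapLike here      (x ∷ y ∷ w) = y ∷ x ∷ w
  swapLike (there s) (x ∷ w)     = x ∷ swapLike s w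

  AdjSwap-swapLike : ∀ {B : Set} {m} {u v : Vec A m} (s : AdjSwap u v) (w : Vec B m) →
                     AdjSwap w (swapLike s w)
  AdjSwap-swapLike here      (x ∷ y ∷ w) = here
  AdjSwap-swapLike (there s) (x ∷ w)     = there (AdjSwap-swapLike s w)

  swapLike-involutive : ∀ {B : Set} {m} {u v : Vec A m} (s : AdjSwap u v) (w : Vec B m) →
                        swapLike s (swapLike s w) ≡ w
  swapLike-involutive here      (x ∷ y ∷ w) = refl
  swapLike-involutive (there s) (x ∷ w)     = cong (x ∷_) (swapLike-involutive s w)

  swapLike-source : ∀ {m} {u v : Vec A m} (s : AdjSwap u v) → swapLike s u ≡ v
  swapLike-source here      = refl
  swapLike-source (there s) = cong (_ ∷_) (swapLike-source s)

  Steps-⊆ : ∀ {m k} {u v : Vec A m} → Steps k u v → u ⊆ v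
  Steps-⊆ done       j = j , refl
  Steps-⊆ (step s r) j =
    let i , vᵢ≡uⱼ = AdjSwap-⊆ s j ; i′ , wᵢ′≡vᵢ = Steps-⊆ r i in i′ , trans wᵢ′≡vᵢ vᵢ≡uⱼ

  ↝-cons : ∀ {m x} {u v : Vec A m} → u ↝ v → (x ∷ u) ↝ (x ∷ v)
  ↝-cons (k , r) = k , cons r
    where
    cons : ∀ {k x} {u v : Vec A _} → Steps k u v → Steps k (x ∷ u) (x ∷ v)
    cons done       = done
    cons (step s r) = step (there s) (cons r)

  ↝-trans : ∀ {m} {u v w : Vec A m} → u ↝ v → v ↝ w → u ↝ w
  ↝-trans (k , r) (l , r′) = k + l , r ◅◅ r′
    where
    _◅◅_ : ∀ {k l} {u v w : Vec A _} → Steps k u v → Steps l v w → Steps (k + l) u w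
    done     ◅◅ r′ = r′
    step s r ◅◅ r′ = step s (r ◅◅ r′)

Steps-map : ∀ {A B : Set} (f : A → B) {m k} {u v : Vec A m} →
            Steps k u v → Steps k (map f u) (map f v)
Steps-map f done       = done
Steps-map f (step s r) = step (adjSwap-map s) (Steps-map f r)
  where
  adjSwap-map : ∀ {m} {u v : Vec _ m} → AdjSwap u v → AdjSwap (map f u) (map f v)
  adjSwap-map here      = here
  adjSwap-map (there s) = there (adjSwap-map s)

module _ {A : Set} where

  bubble : ∀ {m} (u : Vec A (suc m)) i → u ↝ (lookup u i ∷ removeAt u i)
  bubble (x ∷ u)     zero    = 0 , done
  bubble (x ∷ y ∷ u) (suc i) = ↝-trans (↝-cons (bubble (y ∷ u) i)) (1 , step here done)

  -- Decoding of Lehmer codes, using Fin (suc m !) ≅ Fin (suc m) × Fin (m !) (remQuot).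
  decode : ∀ {m} → Fin (m !) → Vec A m → Vec A m
  decodeFrom : ∀ {m} → Fin (suc m) × Fin (m !) → Vec A (suc m) → Vec A (suc m)

  decode {zero}  _ [] = []
  decode {suc m} c u  = decodeFrom (remQuot {suc m} (m !) c) u

  decodeFrom (i , c′) u = lookup u i ∷ decode c′ (removeAt u i)

  decode-reachable : ∀ {m} (c : Fin (m !)) (u : Vec A m) → u ↝ decode c u
  decode-reachable {zero}  c []    = 0 , done
  decode-reachable {suc m} c u =
    let i , c′ = remQuot {suc m} (m !) c
    in ↝-trans (bubble u i) (↝-cons (decode-reachable c′ (removeAt u i)))

  ⊆-removeAt : ∀ {m y} {v : Vec A m} {u : Vec A (suc m)} {i} →
               Distinct (y ∷ v) → (y ∷ v) ⊆ u → lookup u i ≡ y → v ⊆ removeAt u i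
  ⊆-removeAt {y = y} {v} {u} {i} d yv⊆u uᵢ≡y j =
    punchOut i≢i′ , trans (removeAt-punchOut u i≢i′) uᵢ′≡vⱼ
    where
    i′ = proj₁ (yv⊆u (suc j))
    uᵢ′≡vⱼ = proj₂ (yv⊆u (suc j))
    i≢i′ : i ≢ i′
    i≢i′ refl = contradiction (d zero (suc j) (trans (sym uᵢ≡y) uᵢ′≡vⱼ)) λ ()

  decode-onto : ∀ {m} (u v : Vec A m) → Distinct v → v ⊆ u → ∃ λ c → decode c u ≡ v
  decode-onto {zero}  []    []      _ _    = zero , refl
  decode-onto {suc m} u     (y ∷ v) d v⊆u  =
    let i , uᵢ≡y = v⊆u zero
        c′ , decode-c′≡v =
          decode-onto (removeAt u i) v (Distinct-tail d) (⊆-removeAt {u = u} d v⊆u uᵢ≡y)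
    in combine i c′ , (begin
      decode (combine i c′) u                ≡⟨ cong (λ p → decodeFrom p u) (remQuot-combine i c′) ⟩
      lookup u i ∷ decode c′ (removeAt u i)  ≡⟨ cong₂ _∷_ uᵢ≡y decode-c′≡v ⟩
      y ∷ v                                  ∎)

Unique-lookup-injective : ∀ {A : Set} {xs : List A} → Unique xs →
                          ∀ i j → List.lookup xs i ≡ List.lookup xs j → i ≡ j
Unique-lookup-injective (_  ∷ _)   zero    zero    _ = refl
Unique-lookup-injective (x∉ ∷ _)   zero    (suc j) e = contradiction e (All.lookup x∉ (∈-lookup j))
Unique-lookup-injective (x∉ ∷ _)   (suc i) zero    e = contradiction (sym e) (All.lookup x∉ (∈-lookup i))
Unique-lookup-injective (_  ∷ xs!) (suc i) (suc j) e = cong suc (Unique-lookup-injective xs! i j e)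

Unique-length≤ : ∀ {A : Set} {P : A → Set} {xs : List A} {k} → Unique xs → All P xs →
                 (f : ∀ x → P x → Fin k) → (∀ {x y} px py → f x px ≡ f y py → x ≡ y) →
                 length xs ≤ k
Unique-length≤ {P = P} {xs} xs! pxs f f-injective = injective⇒≤ λ {i} {j} fᵢ≡fⱼ →
  Unique-lookup-injective xs! i j (f-injective (p i) (p j) fᵢ≡fⱼ)
  where
  p : ∀ i → P (List.lookup xs i)
  p i = All.lookup pxs (∈-lookup i)

⊆-allFin : ∀ {n k} (v : Vec (Fin n) k) → v ⊆ allFin n
⊆-allFin v j = lookup v j , lookup-allFin (lookup v j)

Distinct-allFin : ∀ n → Distinct (allFin n)
Distinct-allFin n i j e = trans (sym (lookup-allFin i)) (trans e (lookup-allFin j))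

IsPerm-reachable : ∀ {n} (π : Perm n) → IsPerm π → allFin n ↝ π
IsPerm-reachable {n} π π-perm =
  let c , decode-c≡π = decode-onto (allFin n) π π-perm (⊆-allFin π)
  in subst (allFin n ↝_) decode-c≡π (decode-reachable c (allFin n))

IsPerm-surjective : ∀ {n} (σ : Perm n) → IsPerm σ → ∀ z → ∃ λ i → lookup σ i ≡ z
IsPerm-surjective σ σ-perm z =
  let i , σᵢ≡z = Steps-⊆ (proj₂ (IsPerm-reachable σ σ-perm)) z in i , trans σᵢ≡z (lookup-allFin z)

Unique-IsPerm-length≤ : ∀ {n} {L : List (Perm n)} → Unique L → All IsPerm L → length L ≤ n !
Unique-IsPerm-length≤ {n} L! L-perms = Unique-length≤ L! L-perms code code-injective
  where
  code : (v : Perm n) → IsPerm v → Fin (n !)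
  code v v-perm = proj₁ (decode-onto (allFin n) v v-perm (⊆-allFin v))
  code-injective : ∀ {v w} v-perm w-perm → code v v-perm ≡ code w w-perm → v ≡ w
  code-injective {v} {w} v-perm w-perm eq = begin
    v                              ≡⟨ proj₂ (decode-onto (allFin n) v v-perm (⊆-allFin v)) ⟨
    decode (code v v-perm) (allFin n) ≡⟨ cong (λ c → decode c (allFin n)) eq ⟩
    decode (code w w-perm) (allFin n) ≡⟨ proj₂ (decode-onto (allFin n) w w-perm (⊆-allFin w)) ⟩
    w                              ∎

module _ {A : Set} {m} (f : Vec A m → Parity)
         (f-flips : ∀ {u v} → AdjSwap u v → Distinct u → f v ≡ 1ℙ ℙ.+ f u) where

  Steps-parity : ∀ {k u v} → Steps k u v → Distinct u → f v ≡ parity k ℙ.+ f u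
  Steps-parity           done                   d = refl
  Steps-parity {suc k} {u} (step {v = v} {w} s r) d = begin
    f w                           ≡⟨ Steps-parity r (Distinct-AdjSwap s d) ⟩
    parity k ℙ.+ f v              ≡⟨ cong (parity k ℙ.+_) (f-flips s d) ⟩
    parity k ℙ.+ (1ℙ ℙ.+ f u)     ≡⟨ ℙ.+-assoc (parity k) 1ℙ (f u) ⟨
    parity k ℙ.+ 1ℙ ℙ.+ f u       ≡⟨ cong (ℙ._+ f u) (ℙ.+-comm (parity k) 1ℙ) ⟩
    1ℙ ℙ.+ parity k ℙ.+ f u       ≡⟨ cong (ℙ._+ f u) (ℙ.+-homo-+ 1 k) ⟨
    parity (suc k) ℙ.+ f u        ∎

2∣⇒parity≡0ℙ : ∀ {m} → 2 ∣ m → parity m ≡ 0ℙ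
2∣⇒parity≡0ℙ (divides q refl) = trans (ℙ.*-homo-* q 2) (ℙ.*-zeroʳ (parity q))

parity≡0ℙ⇒2∣ : ∀ m → parity m ≡ 0ℙ → 2 ∣ m
parity≡0ℙ⇒2∣ zero          _ = 2 ∣0
parity≡0ℙ⇒2∣ (suc (suc m)) e = ∣m∣n⇒∣m+n ∣-refl (parity≡0ℙ⇒2∣ m e)

count-AdjSwap : ∀ {A : Set} {P : A → Set} (P? : Decidable P) {m} {u v : Vec A m} →
                AdjSwap u v → count P? u ≡ count P? v
count-AdjSwap P? {u = x ∷ y ∷ _} here with does (P? x) | does (P? y)
... | true  | true  = refl
... | true  | false = refl
... | false | true  = refl
... | false | false = refl
count-AdjSwap P? {u = x ∷ _} (there s) = cong (if does (P? x) then suc else id) (count-AdjSwap P? s)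

inversions-swap : ∀ {n m} {x y : Fin n} (zs : Vec (Fin n) m) → x <ᶠ y →
                  inversions (y ∷ x ∷ zs) ≡ suc (inversions (x ∷ y ∷ zs))
inversions-swap {x = x} {y} zs x<y
  rewrite dec-true (x <ᶠ? y) x<y | dec-false (y <ᶠ? x) (<-asym x<y) =
  cong suc (x∙yz≈y∙xz (count (_<ᶠ? y) zs) (count (_<ᶠ? x) zs) (inversions zs))

inversions-AdjSwap : ∀ {n m} {u v : Vec (Fin n) m} → AdjSwap u v → Distinct u →
                     inversions v ≡ suc (inversions u) ⊎ inversions u ≡ suc (inversions v)
inversions-AdjSwap {u = x ∷ y ∷ zs} here d with <-cmp x y
... | tri< x<y _ _ = inj₁ (inversions-swap zs x<y)
... | tri≈ _ x≡y _ = contradiction (d zero (suc zero) x≡y) λ ()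
... | tri> _ _ y<x = inj₂ (inversions-swap zs y<x)
inversions-AdjSwap {u = x ∷ xs} {x ∷ ys} (there s) d
  rewrite count-AdjSwap (_<ᶠ? x) s =
  Sum.map shift shift (inversions-AdjSwap s (Distinct-tail d))
  where
  c = count (_<ᶠ? x) ys
  shift : ∀ {a b} → a ≡ suc b → c + a ≡ suc (c + b)
  shift {b = b} a≡1+b = trans (cong (c +_) a≡1+b) (+-suc c b)

parity-inversions-AdjSwap : ∀ {n m} {u v : Vec (Fin n) m} → AdjSwap u v → Distinct u →
                            parity (inversions v) ≡ 1ℙ ℙ.+ parity (inversions u)
parity-inversions-AdjSwap {u = u} {v} s d with inversions-AdjSwap s d
... | inj₁ v≡1+u = trans (cong parity v≡1+u) (ℙ.+-homo-+ 1 (inversions u))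
... | inj₂ u≡1+v =
  trans (sym (ℙ.suc-homo-⁻¹ (inversions v))) (cong (λ k → parity k ℙ.⁻¹) (sym u≡1+v))

inversions-map-suc : ∀ {n m} (xs : Vec (Fin n) m) → inversions (map suc xs) ≡ inversions xs
inversions-map-suc []       = refl
inversions-map-suc (x ∷ xs) = cong₂ _+_ (count-map-suc xs) (inversions-map-suc xs)
  where
  count-map-suc : ∀ {m} (ys : Vec _ m) → count (_<ᶠ? suc x) (map suc ys) ≡ count (_<ᶠ? x) ys
  count-map-suc []       = refl
  -- does (suc y <ᶠ? suc x) and does (y <ᶠ? x) compute to the same boolean.
  count-map-suc (y ∷ ys) = cong (if does (y <ᶠ? x) then suc else id) (count-map-suc ys)

inversions-allFin : ∀ n → inversions (allFin n) ≡ 0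
inversions-allFin zero    = refl
inversions-allFin (suc n) = begin
  inversions (allFin (suc n))
    ≡⟨ cong inversions (allFin-map n) ⟩
  count (_<ᶠ? zero {n}) (map suc (allFin n)) + inversions (map suc (allFin n))
    ≡⟨ cong₂ _+_ (count-<zero (map suc (allFin n))) (inversions-map-suc (allFin n)) ⟩
  inversions (allFin n)
    ≡⟨ inversions-allFin n ⟩
  0 ∎
  where
  count-<zero : ∀ {m} (ys : Vec (Fin (suc n)) m) → count (_<ᶠ? zero {n}) ys ≡ 0
  count-<zero []       = refl
  count-<zero (y ∷ ys) = count-<zero ys

parity-inversions-Steps : ∀ {n k} {π : Perm n} → Steps k (allFin n) π →
                          parity (inversions π) ≡ parity k
parity-inversions-Steps {n} {k} {π} r = begin
  parity (inversions π)
    ≡⟨ Steps-parity (parity ∘ inversions) parity-inversions-AdjSwap r (Distinct-allFin n) ⟩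
  parity k ℙ.+ parity (inversions (allFin n))
    ≡⟨ cong (λ i → parity k ℙ.+ parity i) (inversions-allFin n) ⟩
  parity k ℙ.+ 0ℙ
    ≡⟨ ℙ.+-identityʳ (parity k) ⟩
  parity k ∎

IsPerm-∘ₚʳ : ∀ {n} (σ π : Perm n) → IsPerm (σ ∘ₚ π) → IsPerm π
IsPerm-∘ₚʳ σ π σπ-perm i j πᵢ≡πⱼ = σπ-perm i j (begin
  lookup (σ ∘ₚ π) i    ≡⟨ lookup-map i (lookup σ) π ⟩
  lookup σ (lookup π i) ≡⟨ cong (lookup σ) πᵢ≡πⱼ ⟩
  lookup σ (lookup π j) ≡⟨ lookup-map j (lookup σ) π ⟨
  lookup (σ ∘ₚ π) j    ∎)

∘ₚ-leftDivide : ∀ {n} (σ τ : Perm n) → IsPerm σ → IsPerm τ →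
                Σ (Perm n) λ π → IsPerm π × σ ∘ₚ π ≡ τ
∘ₚ-leftDivide {n} σ τ σ-perm τ-perm =
  π , IsPerm-∘ₚʳ σ π (subst IsPerm (sym σπ≡τ) τ-perm) , σπ≡τ
  where
  preimage : ∀ i → ∃ λ j → lookup σ j ≡ lookup τ i
  preimage i = IsPerm-surjective σ σ-perm (lookup τ i)
  π : Perm n
  π = tabulate (proj₁ ∘ preimage)
  σπ≡τ : σ ∘ₚ π ≡ τ
  σπ≡τ = begin
    map (lookup σ) (tabulate (proj₁ ∘ preimage)) ≡⟨ tabulate-∘ (lookup σ) (proj₁ ∘ preimage) ⟨
    tabulate (lookup σ ∘ proj₁ ∘ preimage)       ≡⟨ tabulate-cong (proj₂ ∘ preimage) ⟩
    tabulate (lookup τ)                          ≡⟨ tabulate∘lookup τ ⟩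
    τ                                            ∎

AdjSwap⇒DistK1 : ∀ {n} {u v : Perm n} → AdjSwap u v → IsPerm u → DistK v u 1
AdjSwap⇒DistK1 {u = u} s u-perm = step s done , positive
  where
  positive : ∀ k → Steps k u _ → 1 ≤ k
  positive zero    done = contradiction refl (AdjSwap-≢ s u-perm)
  positive (suc k) _    = s≤s z≤n

MinDistGt1⇒independent : ∀ {n} {C : List (Perm n)} → MinDistGt1 C →
                         ∀ {u v} → AdjSwap u v → IsPerm u → u ∈ C → v ∉ C
MinDistGt1⇒independent C-dist {u} {v} s u-perm u∈C v∈C =
  <-irrefl refl (C-dist v u v∈C u∈C (≢-sym (AdjSwap-≢ s u-perm)) 1 (AdjSwap⇒DistK1 s u-perm))

TwoBalanced⇒half : ∀ {n} {C : List (Perm n)} → TwoBalanced C → n ! ≤ length C + length C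
TwoBalanced⇒half {n} {C} C-balanced = ≤-reflexive (begin
  n !                   ≡⟨ half+half n (subst (2 ≤_) halfSize size) ⟨
  n ! / 2 + n ! / 2     ≡⟨ cong₂ _+_ halfSize halfSize ⟨
  length C + length C   ∎)
  where
  open TwoBalanced C-balanced
  open IsCode code
  half+half : ∀ n → 2 ≤ n ! / 2 → n ! / 2 + n ! / 2 ≡ n !
  half+half 0             ()
  half+half 1             ()
  half+half (suc (suc n)) _ = begin
    m / 2 + m / 2       ≡⟨ cong (m / 2 +_) (+-identityʳ (m / 2)) ⟨
    2 * (m / 2)         ≡⟨ *-comm 2 (m / 2) ⟩
    m / 2 * 2           ≡⟨ m/n*n≡m (m≤n⇒m!∣n! {2} {suc (suc n)} (s≤s (s≤s z≤n))) ⟩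
    m                   ∎
    where m = suc (suc n) !

module HalfIndependent {n} {C : List (Perm n)}
         (C-perms : All IsPerm C) (C-unique : Unique C)
         (C-independent : ∀ {u v} → AdjSwap u v → IsPerm u → u ∈ C → v ∉ C)
         (C-half : n ! ≤ length C + length C) where

  open import Data.List.Membership.DecPropositional (≡-dec {n = n} (_≟ᶠ_ {n})) using (_∈?_)

  C-dominating : ∀ {u v} → AdjSwap u v → IsPerm u → u ∉ C → v ∉ C → ⊥
  C-dominating {u} {v} s u-perm u∉C v∉C =
    <-irrefl refl (≤-trans (subst (λ l → suc l ≤ n !) length-D D-bound) C-half)
    where
    g : Perm n → Perm n
    g = swapLike s
    D = C ++ List.map g C
    g-injective : ∀ {x y} → g x ≡ g y → x ≡ y
    g-injective {x} {y} gx≡gy =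
      trans (sym (swapLike-involutive s x)) (trans (cong g gx≡gy) (swapLike-involutive s y))
    C#gC : Disjoint C (List.map g C)
    C#gC (x∈C , x∈gC) with ∈-map⁻ g x∈gC
    ... | y , y∈C , refl = C-independent (AdjSwap-swapLike s y) (All.lookup C-perms y∈C) y∈C x∈C
    u∉D : u ∉ D
    u∉D u∈D with ∈-++⁻ C u∈D
    ... | inj₁ u∈C  = u∉C u∈C
    ... | inj₂ u∈gC with ∈-map⁻ g u∈gC
    ...   | y , y∈C , u≡gy = v∉C (subst (_∈ C) y≡v y∈C)
      where
      y≡v : y ≡ v
      y≡v = trans (sym (swapLike-involutive s y)) (trans (cong g (sym u≡gy)) (swapLike-source s))
    D-bound : length (u ∷ D) ≤ n !
    D-bound = Unique-IsPerm-length≤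
      (All.¬Any⇒All¬ D u∉D ∷ Unique.++⁺ C-unique (Unique.map⁺ g-injective C-unique) C#gC)
      (u-perm ∷ All.++⁺ C-perms (All.map⁺ (All.map (Distinct-AdjSwap (AdjSwap-swapLike s _))
                                                    C-perms)))
    length-D : length D ≡ length C + length C
    length-D = trans (length-++ C) (cong (length C +_) (length-map g C))

  indicator : Perm n → Parity
  indicator v = if does (v ∈? C) then 1ℙ else 0ℙ

  indicator-∈ : ∀ {v} → v ∈ C → indicator v ≡ 1ℙ
  indicator-∈ {v} v∈C with v ∈? C
  ... | yes _  = refl
  ... | no v∉C = contradiction v∈C v∉C

  indicator≡1ℙ⇒∈ : ∀ {v} → indicator v ≡ 1ℙ → v ∈ C
  indicator≡1ℙ⇒∈ {v} _ with v ∈? C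
  indicator≡1ℙ⇒∈ _  | yes v∈C = v∈C
  indicator≡1ℙ⇒∈ () | no _

  indicator-AdjSwap : ∀ {u v} → AdjSwap u v → IsPerm u → indicator v ≡ 1ℙ ℙ.+ indicator u
  indicator-AdjSwap {u} {v} s u-perm with u ∈? C | v ∈? C
  ... | yes u∈C | yes v∈C = contradiction v∈C (C-independent s u-perm u∈C)
  ... | yes _   | no _    = refl
  ... | no _    | yes _   = refl
  ... | no u∉C  | no v∉C  = contradiction v∉C (C-dominating s u-perm u∉C)

  indicator-∘ₚ : ∀ σ π → IsPerm σ → IsPerm π →
                 indicator (σ ∘ₚ π) ≡ parity (inversions π) ℙ.+ indicator σ
  indicator-∘ₚ σ π σ-perm π-perm = begin
    indicator (σ ∘ₚ π)                    ≡⟨ Steps-parity indicator indicator-AdjSwap σ↝σπ σ-perm ⟩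
    parity k ℙ.+ indicator σ              ≡⟨ cong (ℙ._+ indicator σ) (parity-inversions-Steps id↝π) ⟨
    parity (inversions π) ℙ.+ indicator σ ∎
    where
    k = proj₁ (IsPerm-reachable π π-perm)
    id↝π = proj₂ (IsPerm-reachable π π-perm)
    σ↝σπ : Steps k σ (σ ∘ₚ π)
    σ↝σπ = subst (λ w → Steps k w (σ ∘ₚ π)) (map-lookup-allFin σ) (Steps-map (lookup σ) id↝π)

  ∘ₚ∈⇔IsEven : ∀ {σ} π → σ ∈ C → IsPerm σ → IsPerm π → (σ ∘ₚ π ∈ C ⇔ IsEven π)
  ∘ₚ∈⇔IsEven {σ} π σ∈C σ-perm π-perm = mk⇔
    (λ σπ∈C → parity≡0ℙ⇒2∣ _ (ℙ.+-cancelʳ-≡ 1ℙ _ _ (trans (sym indicator-σπ) (indicator-∈ σπ∈C))))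
    (λ π-even → indicator≡1ℙ⇒∈ (trans indicator-σπ (cong (ℙ._+ 1ℙ) (2∣⇒parity≡0ℙ π-even))))
    where
    indicator-σπ : indicator (σ ∘ₚ π) ≡ parity (inversions π) ℙ.+ 1ℙ
    indicator-σπ = trans (indicator-∘ₚ σ π σ-perm π-perm)
                         (cong (parity (inversions π) ℙ.+_) (indicator-∈ σ∈C))

theorem4p6 : (n : ℕ) (C : List (Perm n)) → TwoBalanced C →
    Σ (Perm n) λ σ → IsPerm σ ×
      (∀ τ → (τ ∈ C → Σ (Perm n) λ π → IsPerm π × IsEven π × τ ≡ σ ∘ₚ π)
           × ((Σ (Perm n) λ π → IsPerm π × IsEven π × τ ≡ σ ∘ₚ π) → τ ∈ C))
theorem4p6 n []      C-balanced = contradiction (IsCode.size (TwoBalanced.code C-balanced)) λ ()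
theorem4p6 n (σ ∷ C′) C-balanced = σ , σ-perm , λ τ → coset⊆ τ , coset⊇ τ
  where
  open TwoBalanced C-balanced
  open IsCode code
  open HalfIndependent perms unique (MinDistGt1⇒independent minDist) (TwoBalanced⇒half C-balanced)
  σ-perm : IsPerm σ
  σ-perm = All.head perms
  σπ∈C⇔π-even : ∀ π → IsPerm π → (σ ∘ₚ π ∈ σ ∷ C′ ⇔ IsEven π)
  σπ∈C⇔π-even π = ∘ₚ∈⇔IsEven π (here refl) σ-perm
  coset⊆ : ∀ τ → τ ∈ σ ∷ C′ → Σ (Perm n) λ π → IsPerm π × IsEven π × τ ≡ σ ∘ₚ π
  coset⊆ τ τ∈C =
    let π , π-perm , σπ≡τ = ∘ₚ-leftDivide σ τ σ-perm (All.lookup perms τ∈C)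
        σπ∈C = subst (_∈ σ ∷ C′) (sym σπ≡τ) τ∈C
    in π , π-perm , Equivalence.to (σπ∈C⇔π-even π π-perm) σπ∈C , sym σπ≡τ
  coset⊇ : ∀ τ → (Σ (Perm n) λ π → IsPerm π × IsEven π × τ ≡ σ ∘ₚ π) → τ ∈ σ ∷ C′
  coset⊇ τ (π , π-perm , π-even , refl) = Equivalence.from (σπ∈C⇔π-even π π-perm) π-even
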